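{- Let $n=p_1^{m_1}p_2^{m_2}\cdots p_k^{m_k}$, where $p_1,\dots,p_k$ are distinct primes, $m_1,\dots,m_k$ are positive integers, and $n$ is not prime. Then $0$ is not an eigenvalue of the adjacency matrix of the essential ideal graph $\mathcal{E}_{\mathbb{Z}_n}$ if and only if either ($k=1$ and $m_1>2$) or $m_i=1$ for all $1\le i\le k$.
   Context: $\mathbb{Z}_n$ is the ring of integers modulo $n$. An ideal $I$ of a commutative ring $R$ is essential if $I\cap J\neq\{0\}$ for every nonzero ideal $J$ of $R$. The essential ideal graph $\mathcal{E}_{\mathbb{Z}_n}$ is the simple graph whose vertex set is the set of all nonzero proper ideals of $\mathbb{Z}_n$, two distinct vertices $I,K$ being adjacent if and only if $I+K$ is an essential ideal of $\mathbb{Z}_n$. -}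

module Defs where

open import Data.Bool using (Bool; true; false; _∧_; _∨_; not; if_then_else_)
open import Data.Nat using (ℕ; zero; suc; _+_; _*_; _^_; _≡ᵇ_)
open import Data.Nat.DivMod using (_mod_)
open import Data.Fin using (Fin; toℕ; _≟_)
open import Data.Fin.Subset using (Subset; _∩_)
open import Data.Vec using (Vec; []; _∷_; lookup; tabulate)
open import Data.List using (List; []; _∷_; _++_; map; allFin; filterᵇ; length)
open import Data.Bool.ListAction using (all; any)
import Data.List as L
open import Data.Rational using (ℚ; 0ℚ; 1ℚ; _+_; _*_)
open import Data.Product using (Σ; _×_)
open import Relation.Nullary using (¬_; does)
open import Relation.Binary.PropositionalEquality using (_≡_)

addZ : ∀ {n} → Fin n → Fin n → Fin n
addZ {suc m} a b = (toℕ a Data.Nat.+ toℕ b) mod suc m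

mulZ : ∀ {n} → Fin n → Fin n → Fin n
mulZ {suc m} a b = (toℕ a Data.Nat.* toℕ b) mod suc m

isZeroElt : ∀ {n} → Fin n → Bool
isZeroElt a = toℕ a ≡ᵇ 0

eqᵇ : ∀ {n} → Fin n → Fin n → Bool
eqᵇ a b = does (a ≟ b)

allSubsets : ∀ n → List (Subset n)
allSubsets zero    = [] ∷ []
allSubsets (suc n) = map (true ∷_) (allSubsets n) L.++ map (false ∷_) (allSubsets n)

_∋_ : ∀ {n} → Subset n → Fin n → Bool
S ∋ a = lookup S a

isIdeal : ∀ {n} → Subset n → Bool
isIdeal {n} S =
  any (λ a → (S ∋ a) ∧ isZeroElt a) (allFin n)
  ∧ all (λ a → all (λ b → not ((S ∋ a) ∧ (S ∋ b)) ∨ (S ∋ addZ a b)) (allFin n)) (allFin n)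
  ∧ all (λ r → all (λ a → not (S ∋ a) ∨ (S ∋ mulZ r a)) (allFin n)) (allFin n)

isZeroSet : ∀ {n} → Subset n → Bool
isZeroSet {n} S = all (λ a → not (S ∋ a) ∨ isZeroElt a) (allFin n)

isFull : ∀ {n} → Subset n → Bool
isFull {n} S = all (λ a → S ∋ a) (allFin n)

ideals : ∀ n → List (Subset n)
ideals n = filterᵇ isIdeal (allSubsets n)

sumIdeal : ∀ {n} → Subset n → Subset n → Subset n
sumIdeal {n} I K =
  tabulate (λ x → any (λ a → any (λ b → (I ∋ a) ∧ (K ∋ b) ∧ eqᵇ (addZ a b) x)
                                   (allFin n)) (allFin n))

isEssential : ∀ {n} → Subset n → Bool
isEssential {n} I = all (λ J → isZeroSet J ∨ not (isZeroSet (I ∩ J))) (ideals n)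

-- vertices: nonzero proper ideals of ℤ_n (each listed exactly once)
vertices : ∀ n → List (Subset n)
vertices n = filterᵇ (λ S → not (isZeroSet S) ∧ not (isFull S)) (ideals n)

numVertices : ℕ → ℕ
numVertices n = length (vertices n)

vertex : ∀ n → Fin (numVertices n) → Subset n
vertex n i = L.lookup (vertices n) i

adjacent : ∀ n → Fin (numVertices n) → Fin (numVertices n) → Bool
adjacent n i j = not (eqᵇ i j) ∧ isEssential (sumIdeal (vertex n i) (vertex n j))

adjMatrix : ∀ n → Fin (numVertices n) → Fin (numVertices n) → ℚ
adjMatrix n i j = if adjacent n i j then 1ℚ else 0ℚ

sumℚ : ∀ m → (Fin m → ℚ) → ℚ
sumℚ zero    f = 0ℚ
sumℚ (suc m) f = f Fin.zero Data.Rational.+ sumℚ m (λ i → f (Fin.suc i))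

ZeroIsEigenvalue : ∀ m → (Fin m → Fin m → ℚ) → Set
ZeroIsEigenvalue m A =
  Σ (Fin m → ℚ) λ x →
    (¬ (∀ j → x j ≡ 0ℚ)) × (∀ i → sumℚ m (λ j → A i j Data.Rational.* x j) ≡ 0ℚ)

prodPow : ∀ k → (Fin k → ℕ) → (Fin k → ℕ) → ℕ
prodPow zero    ps ms = 1
prodPow (suc k) ps ms = (ps Fin.zero ^ ms Fin.zero) Data.Nat.* prodPow k (λ i → ps (Fin.suc i)) (λ i → ms (Fin.suc i))

-- Every ideal of ℤ_N is principal, generated by a divisor of N, so the vertices are the
-- divisors 1 < d < N. Every nonzero ideal contains one of the minimal ideals (N/pₗ), and
-- (d) + (d′) meets (N/pₗ) exactly when pₗ^mₗ does not divide both d and d′; hence d and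
-- d′ are adjacent iff they are distinct and no pₗ^mₗ divides both.
-- If N is squarefree, d is adjacent to N/d, whose other neighbours are proper divisors
-- of d, so induction on d shows that A x = 0 forces x = 0. If N = p^m with m > 2 the graph
-- is complete on at least two vertices, so again A is nonsingular. If N = p² the only
-- vertex is p, an isolated vertex. In the remaining cases some mᵢ ≥ 2 and there is a
-- second prime pⱼ; then pⱼ^mⱼ and pⱼ^mⱼ·pᵢ are non-adjacent vertices with the same
-- neighbours, and the difference of their indicator vectors lies in the kernel.

module Submission where

open import Defs
open import Data.Nat using (ℕ; _<_; _≤_)
open import Data.Nat.Primality using (Prime)
open import Data.Fin using (Fin)
open import Data.Product using (_×_)
open import Data.Sum using (_⊎_)
open import Function.Bundles using (_⇔_)
open import Function.Definitions using (Injective)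
open import Relation.Nullary using (¬_)
open import Relation.Binary.PropositionalEquality using (_≡_)

open import Algebra.Bundles using (CommutativeMonoid)
open import Data.Bool using (Bool; true; false; T; T?; not; _∧_; _∨_; if_then_else_)
open import Data.Bool.ListAction using (all; any)
open import Data.Empty using (⊥-elim)
open import Data.Fin as Fin using (zero; suc; toℕ)
import Data.Fin.Properties as Finₚ
open import Data.Fin.Properties using (¬∀⟶∃¬; toℕ-fromℕ<; toℕ-injective; toℕ<n)
open import Data.Fin.Subset using (Subset; _∩_)
import Data.Integer as ℤ
open import Data.List as List using (List; []; _∷_; allFin)
open import Data.List.Membership.Propositional using (_∈_; lose)
open import Data.List.Membership.Propositional.Properties
  using (∈-allFin; ∈-filter⁺; ∈-filter⁻; ∈-lookup; ∈-map⁺; ∈-map⁻; ∈-++⁺ˡ; ∈-++⁺ʳ)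
import Data.List.Relation.Unary.All as All
open import Data.List.Relation.Unary.All.Properties using (all⁺; all⁻)
open import Data.List.Relation.Unary.AllPairs using ([]; _∷_)
open import Data.List.Relation.Unary.Any as Any using (here; there)
open import Data.List.Relation.Unary.Any.Properties using (any⁺; any⁻; lookup-index)
open import Data.List.Relation.Unary.Unique.Propositional using (Unique)
import Data.List.Relation.Unary.Unique.Propositional.Properties as Unique
open import Data.Nat using (zero; suc; _+_; _*_; _%_; _^_; _∸_; NonZero; ≢-nonZero; ≢-nonZero⁻¹; >-nonZero)
open import Data.Nat using (nonTrivial⇒n>1; z≤n; s≤s; s≤s⁻¹; z<s; s<s)
open import Data.Nat.Coprimality using (Coprime; coprime-divisor)
open import Data.Nat.DivMod using (_mod_; m%n<n; m<n⇒m%n≡m; %-distribˡ-+; %-distribˡ-*; [m+kn]%n≡m%n; n%n≡0)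
open import Data.Nat.Divisibility
open import Data.Nat.GCD using (gcd; gcd[m,n]∣m; gcd[m,n]∣n; gcd-GCD; module Bézout)
open import Data.Nat.ListAction using (product)
open import Data.Nat.Primality using (prime⇒irreducible; prime⇒nonZero; prime⇒nonTrivial; ¬prime[1]; euclidsLemma)
open import Data.Nat.Primality.Factorisation using (factorise)
open import Data.Nat.Properties
open import Data.Nat.Tactic.RingSolver using (solve-∀)
open import Data.Product using (∃; _,_; proj₁; proj₂)
open import Data.Rational using (ℚ; 0ℚ; 1ℚ)
import Data.Rational as ℚ
import Data.Rational.Properties as ℚ
open import Data.Sum using (inj₁; inj₂; [_,_]′)
open import Data.Unit using (tt)
import Data.Vec as Vec
open import Data.Vec.Properties using (lookup-zipWith; lookup∘tabulate; tabulate∘lookup; tabulate-cong)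
open import Function using (id; _∘_)
open import Function.Bundles using (mk⇔; Equivalence)
open import Relation.Nullary using (Dec; yes; no; does)
open import Relation.Binary.PropositionalEquality
  using (_≢_; refl; sym; trans; cong; cong₂; subst; subst₂; module ≡-Reasoning)

open import Algebra.Properties.CommutativeSemigroup (CommutativeMonoid.commutativeSemigroup ℚ.+-0-commutativeMonoid)
  using (xy∙z≈zy∙x)

T-does⁻ : ∀ {P : Set} (P? : Dec P) → T (does P?) → P
T-does⁻ (yes p) _ = p

T-does⁺ : ∀ {P : Set} (P? : Dec P) → P → T (does P?)
T-does⁺ (yes _) _ = tt
T-does⁺ (no ¬p) p = ¬p p

T-not⁺ : ∀ {b} → ¬ T b → T (not b)
T-not⁺ {false} _ = tt
T-not⁺ {true} ¬t = ¬t tt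

T-not⁻ : ∀ {b} → T (not b) → ¬ T b
T-not⁻ {false} _ ()

T-∧⁺ : ∀ {a b} → T a → T b → T (a ∧ b)
T-∧⁺ {true} _ tb = tb

T-∧⁻ : ∀ {a b} → T (a ∧ b) → T a × T b
T-∧⁻ {true} tb = tt , tb

T-injective : ∀ {a b} → (T a → T b) → (T b → T a) → a ≡ b
T-injective {false} {false} _ _ = refl
T-injective {false} {true} _ b⇒a = ⊥-elim (b⇒a tt)
T-injective {true} {false} a⇒b _ = ⊥-elim (a⇒b tt)
T-injective {true} {true} _ _ = refl

T-implies⁺ : ∀ {a b} → (T a → T b) → T (not a ∨ b)
T-implies⁺ {false} _ = tt
T-implies⁺ {true} f = f tt

T-implies⁻ : ∀ {a b} → T (not a ∨ b) → T a → T b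
T-implies⁻ {true} tb _ = tb

¬T-implies : ∀ {a b} → ¬ T (not a ∨ b) → T a × ¬ T b
¬T-implies {false} ¬t = ⊥-elim (¬t tt)
¬T-implies {true} {false} _ = tt , λ ()
¬T-implies {true} {true} ¬t = ⊥-elim (¬t tt)

T-∨-not⁺ : ∀ {a b} → (¬ T a → ¬ T b) → T (a ∨ not b)
T-∨-not⁺ {true} _ = tt
T-∨-not⁺ {false} {false} _ = tt
T-∨-not⁺ {false} {true} ¬b = ¬b (λ ()) tt

T-∨-not⁻ : ∀ {a b} → T (a ∨ not b) → ¬ T a → ¬ T b
T-∨-not⁻ {true} _ ¬a = ⊥-elim (¬a tt)
T-∨-not⁻ {false} {false} _ _ ()

all-allFin⁺ : ∀ {n} (p : Fin n → Bool) → (∀ i → T (p i)) → T (all p (allFin n))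
all-allFin⁺ {n} p h = all⁻ p {allFin n} (All.tabulate λ {i} _ → h i)

all-allFin⁻ : ∀ {n} (p : Fin n → Bool) → T (all p (allFin n)) → ∀ i → T (p i)
all-allFin⁻ p h i = All.lookup (all⁺ p _ h) (∈-allFin i)

any-allFin⁺ : ∀ {n} (p : Fin n → Bool) i → T (p i) → T (any p (allFin n))
any-allFin⁺ {n} p i h = any⁺ {xs = allFin n} p (lose (∈-allFin i) h)

any-allFin⁻ : ∀ {n} (p : Fin n → Bool) → T (any p (allFin n)) → ∃ λ i → T (p i)
any-allFin⁻ {n} p h = Any.satisfied (any⁻ p (allFin n) h)

¬all-allFin : ∀ {n} (p : Fin n → Bool) → ¬ T (all p (allFin n)) → ∃ λ i → ¬ T (p i)
¬all-allFin {n} p ¬all = ¬∀⟶∃¬ n (T ∘ p) (T? ∘ p) (¬all ∘ all-allFin⁺ p)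

isZeroSet⁻ : ∀ {n} (S : Subset n) → T (isZeroSet S) → ∀ {a} → T (S ∋ a) → toℕ a ≡ 0
isZeroSet⁻ S zeroSet {a} a∈ =
  ≡ᵇ⇒≡ (toℕ a) 0 (T-implies⁻ (all-allFin⁻ (λ a → not (S ∋ a) ∨ isZeroElt a) zeroSet a) a∈)

¬isZeroSet⁻ : ∀ {n} (S : Subset n) → ¬ T (isZeroSet S) → ∃ λ a → T (S ∋ a) × toℕ a ≢ 0
¬isZeroSet⁻ S nonzero with ¬all-allFin (λ a → not (S ∋ a) ∨ isZeroElt a) nonzero
... | a , ¬implies with ¬T-implies {S ∋ a} ¬implies
...   | a∈ , ¬a≡0 = a , a∈ , ¬a≡0 ∘ ≡⇒≡ᵇ (toℕ a) 0

isFull⁻ : ∀ {n} (S : Subset n) → T (isFull S) → ∀ a → T (S ∋ a)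
isFull⁻ S = all-allFin⁻ (S ∋_)

lookup-injective : ∀ {A : Set} {xs : List A} → Unique xs →
                   ∀ i j → List.lookup xs i ≡ List.lookup xs j → i ≡ j
lookup-injective (_ ∷ _) zero zero _ = refl
lookup-injective (x∉ ∷ _) zero (suc j) eq = ⊥-elim (All.lookup x∉ (∈-lookup j) eq)
lookup-injective (x∉ ∷ _) (suc i) zero eq = ⊥-elim (All.lookup x∉ (∈-lookup i) (sym eq))
lookup-injective (_ ∷ u) (suc i) (suc j) eq = cong suc (lookup-injective u i j eq)

∈-allSubsets : ∀ n (S : Subset n) → S ∈ allSubsets n
∈-allSubsets zero Vec.[] = here refl
∈-allSubsets (suc n) (true Vec.∷ S) = ∈-++⁺ˡ (∈-map⁺ (true Vec.∷_) (∈-allSubsets n S))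
∈-allSubsets (suc n) (false Vec.∷ S) =
  ∈-++⁺ʳ (List.map (true Vec.∷_) (allSubsets n)) (∈-map⁺ (false Vec.∷_) (∈-allSubsets n S))

allSubsets-unique : ∀ n → Unique (allSubsets n)
allSubsets-unique zero = All.[] ∷ []
allSubsets-unique (suc n) =
  Unique.++⁺ (Unique.map⁺ ∷-injectiveʳ (allSubsets-unique n)) (Unique.map⁺ ∷-injectiveʳ (allSubsets-unique n))
             disjoint
  where
  ∷-injectiveʳ : ∀ {b} {S S′ : Subset n} → b Vec.∷ S ≡ b Vec.∷ S′ → S ≡ S′
  ∷-injectiveʳ refl = refl
  disjoint : ∀ {S} → ¬ (S ∈ List.map (true Vec.∷_) (allSubsets n) × S ∈ List.map (false Vec.∷_) (allSubsets n))
  disjoint (p , q) with ∈-map⁻ (true Vec.∷_) p | ∈-map⁻ (false Vec.∷_) q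
  ... | _ , _ , refl | _ , _ , ()

∈-ideals⁺ : ∀ {n} {S : Subset n} → T (isIdeal S) → S ∈ ideals n
∈-ideals⁺ {n} {S} = ∈-filter⁺ (T? ∘ isIdeal) (∈-allSubsets n S)

∈-ideals⁻ : ∀ {n} {S : Subset n} → S ∈ ideals n → T (isIdeal S)
∈-ideals⁻ {n} S∈ = proj₂ (∈-filter⁻ (T? ∘ isIdeal) {xs = allSubsets n} S∈)

∈-vertices⁺ : ∀ {n} {S : Subset n} → T (isIdeal S) → ¬ T (isZeroSet S) → ¬ T (isFull S) → S ∈ vertices n
∈-vertices⁺ ideal nonzero proper =
  ∈-filter⁺ (T? ∘ _) (∈-ideals⁺ ideal) (T-∧⁺ (T-not⁺ nonzero) (T-not⁺ proper))

∈-vertices⁻ : ∀ {n} {S : Subset n} → S ∈ vertices n → T (isIdeal S) × ¬ T (isZeroSet S) × ¬ T (isFull S)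
∈-vertices⁻ S∈ with ∈-filter⁻ (T? ∘ _) S∈
... | S∈ideals , both with T-∧⁻ both
...   | nonzero , proper = ∈-ideals⁻ S∈ideals , T-not⁻ nonzero , T-not⁻ proper

vertex-valid : ∀ n i → T (isIdeal (vertex n i)) × ¬ T (isZeroSet (vertex n i)) × ¬ T (isFull (vertex n i))
vertex-valid n i = ∈-vertices⁻ {S = vertex n i} (∈-lookup {xs = vertices n} i)

vertex-injective : ∀ n → Injective _≡_ _≡_ (vertex n)
vertex-injective n =
  lookup-injective (Unique.filter⁺ (T? ∘ _) (Unique.filter⁺ (T? ∘ isIdeal) (allSubsets-unique n))) _ _

vertex-surjective : ∀ {n} {S : Subset n} → S ∈ vertices n → ∃ λ i → vertex n i ≡ S
vertex-surjective S∈ = Any.index S∈ , sym (lookup-index S∈)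

x+y+m*y≡x+y*[1+m] : ∀ x y m → x + y + m * y ≡ x + y * suc m
x+y+m*y≡x+y*[1+m] = solve-∀

x*[y*z]≡y*[x*z] : ∀ x y z → x * (y * z) ≡ y * (x * z)
x*[y*z]≡y*[x*z] = solve-∀

x*[y*z]≡z*[x*y] : ∀ x y z → x * (y * z) ≡ z * (x * y)
x*[y*z]≡z*[x*y] = solve-∀

x*y*z≡x*z*y : ∀ x y z → x * y * z ≡ x * z * y
x*y*z≡x*z*y = solve-∀

x*y*z≡y*[x*z] : ∀ x y z → x * y * z ≡ y * (x * z)
x*y*z≡y*[x*z] = solve-∀

prime-divisor : ∀ {n} → 1 < n → ∃ λ q → Prime q × q ∣ n
prime-divisor {n} 1<n with factorise n {{>-nonZero (<-trans z<s 1<n)}}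
... | record { factors = [] ; isFactorisation = n≡1 } = ⊥-elim (<⇒≢ 1<n (sym n≡1))
... | record { factors = q ∷ qs ; isFactorisation = n≡ ; factorsPrime = q-prime All.∷ _ } =
  q , q-prime , divides (product qs) (trans n≡ (*-comm q _))

prime∣prime⇒≡ : ∀ {p q} → Prime q → Prime p → q ∣ p → q ≡ p
prime∣prime⇒≡ q-prime p-prime q∣p with prime⇒irreducible p-prime q∣p
... | inj₁ refl = ⊥-elim (¬prime[1] q-prime)
... | inj₂ q≡p = q≡p

prime∣^⇒∣ : ∀ {p q} e → Prime q → q ∣ p ^ e → q ∣ p
prime∣^⇒∣ zero q-prime q∣1 = ⊥-elim (¬prime[1] (subst Prime (∣1⇒≡1 q∣1) q-prime))
prime∣^⇒∣ {p} (suc e) q-prime q∣p^e with euclidsLemma p (p ^ e) q-prime q∣p^e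
... | inj₁ q∣p = q∣p
... | inj₂ q∣p^e = prime∣^⇒∣ e q-prime q∣p^e

no-prime-divisor⇒≡1 : ∀ {n} → n ≢ 0 → (∀ {q} → Prime q → ¬ q ∣ n) → n ≡ 1
no-prime-divisor⇒≡1 {zero} n≢0 _ = ⊥-elim (n≢0 refl)
no-prime-divisor⇒≡1 {suc zero} _ _ = refl
no-prime-divisor⇒≡1 {suc (suc n)} _ no-prime =
  let q , q-prime , q∣n = prime-divisor {suc (suc n)} (s<s z<s) in ⊥-elim (no-prime q-prime q∣n)

no-common-prime⇒coprime : ∀ {m n} → .{{NonZero m}} → (∀ {q} → Prime q → q ∣ m → ¬ q ∣ n) → Coprime m n
no-common-prime⇒coprime {m} no-common (d∣m , d∣n) =
  no-prime-divisor⇒≡1 (λ { refl → ≢-nonZero⁻¹ m (0∣⇒≡0 d∣m) }) λ q-prime q∣d →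
    no-common q-prime (∣-trans q∣d d∣m) (∣-trans q∣d d∣n)

n∣n^m : ∀ n {m} → 1 ≤ m → n ∣ n ^ m
n∣n^m n {suc m} _ = m∣m*n (n ^ m)

n*n∣n^m : ∀ n {m} → 2 ≤ m → n * n ∣ n ^ m
n*n∣n^m n {suc zero} (s≤s ())
n*n∣n^m n {suc (suc m)} _ = divides (n ^ m) (x*[y*z]≡z*[x*y] n n (n ^ m))

n*n<n^m : ∀ {n m} → 1 < n → 2 < m → n * n < n ^ m
n*n<n^m {m = suc (suc zero)} _ (s<s (s<s ()))
n*n<n^m {n} {suc (suc (suc m))} 1<n _ =
  subst (n * n <_) (*-assoc n n (n ^ suc m)) (m<m*n (n * n) (n ^ suc m) {{n²≢0}} 1<n^[1+m])
  where
  n≢0 = >-nonZero (<-trans z<s 1<n)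
  n²≢0 = m*n≢0 n n {{n≢0}} {{n≢0}}
  1<n^[1+m] : 1 < n ^ suc m
  1<n^[1+m] = <-≤-trans 1<n (m≤m*n n (n ^ m) {{m^n≢0 n m {{n≢0}}}})

prime^-coprime : ∀ {p n} e → Prime p → ¬ p ∣ n → Coprime (p ^ e) n
prime^-coprime {p} e p-prime p∤n =
  no-common-prime⇒coprime {{m^n≢0 p e {{prime⇒nonZero p-prime}}}} λ q-prime q∣p^e q∣n →
  p∤n (subst (_∣ _) (prime∣prime⇒≡ q-prime p-prime (prime∣^⇒∣ e q-prime q∣p^e)) q∣n)

prodPow-primeDivisor : ∀ k (ps ms : Fin k → ℕ) → (∀ l → Prime (ps l)) →
                       ∀ {q} → Prime q → q ∣ prodPow k ps ms → ∃ λ l → q ≡ ps l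
prodPow-primeDivisor zero ps ms _ q-prime q∣1 = ⊥-elim (¬prime[1] (subst Prime (∣1⇒≡1 q∣1) q-prime))
prodPow-primeDivisor (suc k) ps ms primes q-prime q∣
  with euclidsLemma (ps zero ^ ms zero) _ q-prime q∣
... | inj₁ q∣head = zero , prime∣prime⇒≡ q-prime (primes zero) (prime∣^⇒∣ (ms zero) q-prime q∣head)
... | inj₂ q∣tail with prodPow-primeDivisor k (ps ∘ suc) (ms ∘ suc) (primes ∘ suc) q-prime q∣tail
...   | l , q≡ = suc l , q≡

prodPow-split : ∀ k (ps ms : Fin k → ℕ) → (∀ l → Prime (ps l)) → Injective _≡_ _≡_ ps →
                ∀ l → ∃ λ R → prodPow k ps ms ≡ ps l ^ ms l * R × ¬ ps l ∣ R
prodPow-split (suc k) ps ms primes injective zero =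
  prodPow k (ps ∘ suc) (ms ∘ suc) , refl , λ p∣tail →
    let l , p≡ = prodPow-primeDivisor k (ps ∘ suc) (ms ∘ suc) (primes ∘ suc) (primes zero) p∣tail
    in Finₚ.0≢1+n (injective p≡)
prodPow-split (suc k) ps ms primes injective (suc l)
  with prodPow-split k (ps ∘ suc) (ms ∘ suc) (primes ∘ suc) (Finₚ.suc-injective ∘ injective) l
... | R , tail≡ , p∤R = ps zero ^ ms zero * R , split , p∤
  where
  split : prodPow (suc k) ps ms ≡ ps (suc l) ^ ms (suc l) * (ps zero ^ ms zero * R)
  split = trans (cong (ps zero ^ ms zero *_) tail≡)
                (x*[y*z]≡y*[x*z] (ps zero ^ ms zero) (ps (suc l) ^ ms (suc l)) R)
  p∤ : ¬ ps (suc l) ∣ ps zero ^ ms zero * R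
  p∤ p∣ with euclidsLemma (ps zero ^ ms zero) R (primes (suc l)) p∣
  ... | inj₁ p∣head = Finₚ.0≢1+n (sym (injective
          (prime∣prime⇒≡ (primes (suc l)) (primes zero) (prime∣^⇒∣ (ms zero) (primes (suc l)) p∣head))))
  ... | inj₂ p∣R = p∤R p∣R

prodPow-nonZero : ∀ k (ps ms : Fin k → ℕ) → (∀ l → Prime (ps l)) → NonZero (prodPow k ps ms)
prodPow-nonZero zero ps ms _ = _
prodPow-nonZero (suc k) ps ms primes =
  m*n≢0 (ps zero ^ ms zero) _ {{m^n≢0 (ps zero) (ms zero) {{prime⇒nonZero (primes zero)}}}}
        {{prodPow-nonZero k (ps ∘ suc) (ms ∘ suc) (primes ∘ suc)}}

record Factorisation (N : ℕ) {k : ℕ} (ps ms : Fin k → ℕ) : Set where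
  field
    prime        : ∀ l → Prime (ps l)
    injective    : Injective _≡_ _≡_ ps
    exponent≥1   : ∀ l → 1 ≤ ms l
    cofactor     : Fin k → ℕ
    split        : ∀ l → N ≡ ps l ^ ms l * cofactor l
    ∤cofactor    : ∀ l → ¬ ps l ∣ cofactor l
    primeDivisor : ∀ {q} → Prime q → q ∣ N → ∃ λ l → q ≡ ps l

prodPow-factorisation : ∀ k (ps ms : Fin k → ℕ) → (∀ l → Prime (ps l)) → Injective _≡_ _≡_ ps →
                        (∀ l → 1 ≤ ms l) → Factorisation (prodPow k ps ms) ps ms
prodPow-factorisation k ps ms primes injective exponent≥1 = record
  { prime        = primes
  ; injective    = injective
  ; exponent≥1   = exponent≥1
  ; cofactor     = λ l → proj₁ (prodPow-split k ps ms primes injective l)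
  ; split        = λ l → proj₁ (proj₂ (prodPow-split k ps ms primes injective l))
  ; ∤cofactor    = λ l → proj₂ (proj₂ (prodPow-split k ps ms primes injective l))
  ; primeDivisor = prodPow-primeDivisor k ps ms primes
  }

module FactorisationProperties {N k : ℕ} {ps ms : Fin k → ℕ} (F : Factorisation N ps ms)
                               .{{_ : NonZero N}} where
  open Factorisation F

  instance
    p-nonZero : ∀ {l} → NonZero (ps l)
    p-nonZero {l} = prime⇒nonZero (prime l)

  pw : Fin k → ℕ
  pw l = ps l ^ ms l

  N/p : Fin k → ℕ
  N/p l = ps l ^ (ms l ∸ 1) * cofactor l

  N≡p*N/p : ∀ l → N ≡ ps l * N/p l
  N≡p*N/p l with ms l | exponent≥1 l | split l
  ... | suc e | _ | N≡ = trans N≡ (*-assoc (ps l) (ps l ^ e) (cofactor l))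

  p∣N : ∀ l → ps l ∣ N
  p∣N l = divides (N/p l) (trans (N≡p*N/p l) (*-comm (ps l) (N/p l)))

  N/p∣N : ∀ l → N/p l ∣ N
  N/p∣N l = divides (ps l) (N≡p*N/p l)

  pw∣N : ∀ l → pw l ∣ N
  pw∣N l = divides (cofactor l) (trans (split l) (*-comm (pw l) (cofactor l)))

  pw∤N/p : ∀ l → ¬ pw l ∣ N/p l
  pw∤N/p l pw∣N/p = ∤cofactor l (*-cancelˡ-∣ (pw l) {{m^n≢0 (ps l) (ms l)}} (begin
    pw l * ps l     ≡⟨ *-comm (pw l) (ps l) ⟩
    ps l * pw l     ∣⟨ *-monoʳ-∣ (ps l) pw∣N/p ⟩
    ps l * N/p l    ≡⟨ N≡p*N/p l ⟨
    N               ≡⟨ split l ⟩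
    pw l * cofactor l ∎))
    where open ∣-Reasoning

  0<N/p : ∀ l → 0 < N/p l
  0<N/p l = n≢0⇒n>0 λ N/p≡0 →
    ≢-nonZero⁻¹ N (trans (N≡p*N/p l) (trans (cong (ps l *_) N/p≡0) (*-zeroʳ (ps l))))

  N/p<N : ∀ l → N/p l < N
  N/p<N l = subst (N/p l <_) (trans (*-comm (N/p l) (ps l)) (sym (N≡p*N/p l)))
    (m<m*n (N/p l) (ps l) {{>-nonZero (0<N/p l)}} (nonTrivial⇒n>1 (ps l) {{prime⇒nonTrivial (prime l)}}))

  pw∣⇒∤N/p : ∀ l {g} → pw l ∣ g → ¬ g ∣ N/p l
  pw∣⇒∤N/p l pw∣g g∣N/p = pw∤N/p l (∣-trans pw∣g g∣N/p)

  ∤N/p⇒pw∣ : ∀ l {g} → g ∣ N → ¬ g ∣ N/p l → pw l ∣ g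
  ∤N/p⇒pw∣ l {g} (divides h N≡h*g) g∤N/p with ps l ∣? h
  ... | yes (divides h′ refl) = ⊥-elim (g∤N/p (divides h′ (*-cancelˡ-≡ (N/p l) (h′ * g) (ps l)
          (trans (sym (N≡p*N/p l)) (trans N≡h*g (x*y*z≡y*[x*z] h′ (ps l) g))))))
  ... | no p∤h = coprime-divisor (prime^-coprime (ms l) (prime l) p∤h)
                   (subst (pw l ∣_) N≡h*g (pw∣N l))

  pw∤⇒∣N/p : ∀ l {g} → g ∣ N → ¬ pw l ∣ g → g ∣ N/p l
  pw∤⇒∣N/p l {g} g∣N pw∤g with g ∣? N/p l
  ... | yes g∣N/p = g∣N/p
  ... | no g∤N/p = ⊥-elim (pw∤g (∤N/p⇒pw∣ l g∣N g∤N/p))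

  pw∤multiple-of-N/p : ∀ l {y} → 0 < y → y < N → N/p l ∣ y → ¬ pw l ∣ y
  pw∤multiple-of-N/p l {y} 0<y y<N (divides t refl) pw∣y =
    pw∤N/p l (coprime-divisor (prime^-coprime (ms l) (prime l) p∤t) pw∣y)
    where
    0<t : 0 < t
    0<t = n≢0⇒n>0 λ { refl → <⇒≢ 0<y refl }
    t<p : t < ps l
    t<p = *-cancelʳ-< (N/p l) t (ps l) (subst (t * N/p l <_) (N≡p*N/p l) y<N)
    p∤t : ¬ ps l ∣ t
    p∤t p∣t = <⇒≱ t<p (∣⇒≤ {{>-nonZero 0<t}} p∣t)

  proper-divisor⇒∣N/p : ∀ {g} → g ∣ N → g < N → ∃ λ l → g ∣ N/p l
  proper-divisor⇒∣N/p {g} (divides t N≡t*g) g<N with prime-divisor 1<t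
    where
    1<t : 1 < t
    1<t = ≤∧≢⇒< (n≢0⇒n>0 (λ { refl → ≢-nonZero⁻¹ N N≡t*g }))
                (λ { refl → <⇒≢ g<N (sym (trans N≡t*g (*-identityˡ g))) })
  ... | q , q-prime , divides t′ refl
    with primeDivisor q-prime (divides (t′ * g) (trans N≡t*g (x*y*z≡x*z*y t′ q g)))
  ...   | l , refl = l , divides t′ (*-cancelˡ-≡ (N/p l) (t′ * g) (ps l)
                       (trans (sym (N≡p*N/p l)) (trans N≡t*g (x*y*z≡y*[x*z] t′ (ps l) g))))

-- Ideals of ℤ_N

module Ideals (m : ℕ) where

  N : ℕ
  N = suc m

  toℕ-mod : ∀ x → toℕ (x mod N) ≡ x % N
  toℕ-mod x = toℕ-fromℕ< (m%n<n x N)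

  toℕ-mod-< : ∀ {x} → x < N → toℕ (x mod N) ≡ x
  toℕ-mod-< {x} x<N = trans (toℕ-mod x) (m<n⇒m%n≡m x<N)

  mod-toℕ : ∀ (a : Fin N) → toℕ a mod N ≡ a
  mod-toℕ a = toℕ-injective (toℕ-mod-< (toℕ<n a))

  mod-cong : ∀ x y → x % N ≡ y % N → x mod N ≡ y mod N
  mod-cong x y eq = toℕ-injective (trans (toℕ-mod x) (trans eq (sym (toℕ-mod y))))

  toℕ-addZ : ∀ (a b : Fin N) → toℕ (addZ a b) ≡ (toℕ a + toℕ b) % N
  toℕ-addZ a b = toℕ-mod (toℕ a + toℕ b)

  addZ-mod : ∀ x y → addZ (x mod N) (y mod N) ≡ (x + y) mod N
  addZ-mod x y = mod-cong (toℕ (x mod N) + toℕ (y mod N)) (x + y) (begin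
    (toℕ (x mod N) + toℕ (y mod N)) % N ≡⟨ cong₂ (λ u v → (u + v) % N) (toℕ-mod x) (toℕ-mod y) ⟩
    (x % N + y % N) % N                 ≡⟨ %-distribˡ-+ x y N ⟨
    (x + y) % N                         ∎)
    where open ≡-Reasoning

  mulZ-mod : ∀ x y → mulZ (x mod N) (y mod N) ≡ (x * y) mod N
  mulZ-mod x y = mod-cong (toℕ (x mod N) * toℕ (y mod N)) (x * y) (begin
    (toℕ (x mod N) * toℕ (y mod N)) % N ≡⟨ cong₂ (λ u v → (u * v) % N) (toℕ-mod x) (toℕ-mod y) ⟩
    (x % N * (y % N)) % N               ≡⟨ %-distribˡ-* x y N ⟨
    (x * y) % N                         ∎)
    where open ≡-Reasoning

  addZ-identityʳ : ∀ (a : Fin N) → addZ a zero ≡ a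
  addZ-identityʳ a = toℕ-injective
    (trans (toℕ-addZ a zero) (trans (cong (_% N) (+-identityʳ (toℕ a))) (m<n⇒m%n≡m (toℕ<n a))))

  addZ-identityˡ : ∀ (a : Fin N) → addZ zero a ≡ a
  addZ-identityˡ a = toℕ-injective (trans (toℕ-addZ zero a) (m<n⇒m%n≡m (toℕ<n a)))

  _∋ℕ_ : Subset N → ℕ → Set
  S ∋ℕ x = T (S ∋ (x mod N))

  ∋ℕ-cong : ∀ (S : Subset N) x y → x % N ≡ y % N → S ∋ℕ x → S ∋ℕ y
  ∋ℕ-cong S x y eq = subst (T ∘ (S ∋_)) (mod-cong x y eq)

  ∋ℕ⇒∋ : ∀ (S : Subset N) (a : Fin N) → S ∋ℕ toℕ a → T (S ∋ a)
  ∋ℕ⇒∋ S a = subst (T ∘ (S ∋_)) (mod-toℕ a)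

  ∋⇒∋ℕ : ∀ (S : Subset N) (a : Fin N) → T (S ∋ a) → S ∋ℕ toℕ a
  ∋⇒∋ℕ S a = subst (T ∘ (S ∋_)) (sym (mod-toℕ a))

  -- Closure properties read on natural-number representatives, where Bézout's identity applies.
  record Closed (S : Subset N) : Set where
    field
      0∈        : S ∋ℕ 0
      +-closed : ∀ x y → S ∋ℕ x → S ∋ℕ y → S ∋ℕ (x + y)
      *-closed : ∀ r x → S ∋ℕ x → S ∋ℕ (r * x)

  isIdeal⇒Closed : ∀ {S} → T (isIdeal S) → Closed S
  isIdeal⇒Closed {S} ideal = record
    { 0∈       = zero∈
    ; +-closed = λ x y x∈ y∈ → subst (T ∘ (S ∋_)) (addZ-mod x y)
        (T-implies⁻ (all-allFin⁻ _ (all-allFin⁻ _ add (x mod N)) (y mod N)) (T-∧⁺ x∈ y∈))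
    ; *-closed = λ r x x∈ → subst (T ∘ (S ∋_)) (mulZ-mod r x)
        (T-implies⁻ (all-allFin⁻ _ (all-allFin⁻ _ mul (r mod N)) (x mod N)) x∈)
    }
    where
    has0 : T (any (λ a → (S ∋ a) ∧ isZeroElt a) (allFin N))
    has0 = proj₁ (T-∧⁻ ideal)
    add : T (all (λ a → all (λ b → not ((S ∋ a) ∧ (S ∋ b)) ∨ (S ∋ addZ a b)) (allFin N)) (allFin N))
    add = proj₁ (T-∧⁻ (proj₂ (T-∧⁻ {any (λ a → (S ∋ a) ∧ isZeroElt a) (allFin N)} ideal)))
    mul : T (all (λ r → all (λ a → not (S ∋ a) ∨ (S ∋ mulZ r a)) (allFin N)) (allFin N))
    mul = proj₂ (T-∧⁻ {all (λ a → all (λ b → not ((S ∋ a) ∧ (S ∋ b)) ∨ (S ∋ addZ a b)) (allFin N)) (allFin N)}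
                   (proj₂ (T-∧⁻ {any (λ a → (S ∋ a) ∧ isZeroElt a) (allFin N)} ideal)))
    zero∈ : S ∋ℕ 0
    zero∈ with any-allFin⁻ _ has0
    ... | a , a∈∧a≡0 with T-∧⁻ {S ∋ a} a∈∧a≡0
    ...   | a∈ , a≡0 = ∋ℕ-cong S (toℕ a) 0 (cong (_% N) (≡ᵇ⇒≡ (toℕ a) 0 a≡0)) (∋⇒∋ℕ S a a∈)

  module _ {S : Subset N} (closed : Closed S) where
    open Closed closed

    -- m * y represents -y modulo N = suc m.
    +-cancelʳ-closed : ∀ x y → S ∋ℕ (x + y) → S ∋ℕ y → S ∋ℕ x
    +-cancelʳ-closed x y x+y∈ y∈ =
      ∋ℕ-cong S (x + y + m * y) x reduce (+-closed (x + y) (m * y) x+y∈ (*-closed m y y∈))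
      where
      reduce : (x + y + m * y) % N ≡ x % N
      reduce = trans (cong (_% N) (x+y+m*y≡x+y*[1+m] x y m)) ([m+kn]%n≡m%n x y N)

    gcd-closed : ∀ x y → S ∋ℕ x → S ∋ℕ y → S ∋ℕ gcd x y
    gcd-closed x y x∈ y∈ with Bézout.identity (gcd-GCD x y)
    ... | Bézout.+- a b eq =
      +-cancelʳ-closed (gcd x y) (b * y) (subst (S ∋ℕ_) (sym eq) (*-closed a x x∈)) (*-closed b y y∈)
    ... | Bézout.-+ a b eq =
      +-cancelʳ-closed (gcd x y) (a * x) (subst (S ∋ℕ_) (sym eq) (*-closed b y y∈)) (*-closed a x x∈)

    N-closed : S ∋ℕ N
    N-closed = ∋ℕ-cong S 0 N (sym (n%n≡0 N)) 0∈

  gcdOfMembers : Subset N → List (Fin N) → ℕ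
  gcdOfMembers S = List.foldr (λ a g → if S ∋ a then gcd (toℕ a) g else g) N

  gcdOfMembers-∣N : ∀ S xs → gcdOfMembers S xs ∣ N
  gcdOfMembers-∣N S [] = ∣-refl
  gcdOfMembers-∣N S (a ∷ xs) with S ∋ a
  ... | true  = ∣-trans (gcd[m,n]∣n (toℕ a) _) (gcdOfMembers-∣N S xs)
  ... | false = gcdOfMembers-∣N S xs

  gcdOfMembers-∣ : ∀ S xs {a} → a ∈ xs → T (S ∋ a) → gcdOfMembers S xs ∣ toℕ a
  gcdOfMembers-∣ S (b ∷ xs) a∈ a∈S with S ∋ b in eq
  gcdOfMembers-∣ S (b ∷ xs) (here refl) a∈S | true = gcd[m,n]∣m (toℕ b) _
  gcdOfMembers-∣ S (b ∷ xs) (there a∈) a∈S  | true =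
    ∣-trans (gcd[m,n]∣n (toℕ b) _) (gcdOfMembers-∣ S xs a∈ a∈S)
  gcdOfMembers-∣ S (b ∷ xs) (here refl) a∈S | false = ⊥-elim (subst T eq a∈S)
  gcdOfMembers-∣ S (b ∷ xs) (there a∈) a∈S  | false = gcdOfMembers-∣ S xs a∈ a∈S

  gcdOfMembers-closed : ∀ {S} → Closed S → ∀ xs → S ∋ℕ gcdOfMembers S xs
  gcdOfMembers-closed closed [] = N-closed closed
  gcdOfMembers-closed {S} closed (a ∷ xs) with S ∋ a in eq
  ... | true  = gcd-closed closed (toℕ a) _ (∋⇒∋ℕ S a (subst T (sym eq) tt)) (gcdOfMembers-closed closed xs)
  ... | false = gcdOfMembers-closed closed xs

  generator : Subset N → ℕ
  generator S = gcdOfMembers S (allFin N)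

  generator-∣N : ∀ S → generator S ∣ N
  generator-∣N S = gcdOfMembers-∣N S (allFin N)

  generator-∣ : ∀ S {a} → T (S ∋ a) → generator S ∣ toℕ a
  generator-∣ S {a} = gcdOfMembers-∣ S (allFin N) (∈-allFin a)

  principal : ℕ → Subset N
  principal d = Vec.tabulate (λ a → does (d ∣? toℕ a))

  principal-∋⁺ : ∀ {d} a → d ∣ toℕ a → T (principal d ∋ a)
  principal-∋⁺ {d} a d∣a =
    subst T (sym (lookup∘tabulate (λ b → does (d ∣? toℕ b)) a)) (T-does⁺ (d ∣? toℕ a) d∣a)

  principal-∋⁻ : ∀ {d} a → T (principal d ∋ a) → d ∣ toℕ a
  principal-∋⁻ {d} a a∈ =
    T-does⁻ (d ∣? toℕ a) (subst T (lookup∘tabulate (λ b → does (d ∣? toℕ b)) a) a∈)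

  generator-∈ : ∀ {S} → Closed S → ∀ a → generator S ∣ toℕ a → T (S ∋ a)
  generator-∈ {S} closed a (divides q a≡) =
    ∋ℕ⇒∋ S a (subst (S ∋ℕ_) (sym a≡) (Closed.*-closed closed q _ (gcdOfMembers-closed closed (allFin N))))

  generator<N : ∀ S → ¬ T (isZeroSet S) → generator S < N
  generator<N S nonzero with ¬isZeroSet⁻ S nonzero
  ... | a , a∈ , a≢0 = ≤-<-trans (∣⇒≤ {{≢-nonZero a≢0}} (generator-∣ S a∈)) (toℕ<n a)

  closed⇒principal : ∀ {S} → Closed S → S ≡ principal (generator S)
  closed⇒principal {S} closed = trans (sym (tabulate∘lookup S)) (tabulate-cong λ a →
    T-injective (T-does⁺ (_ ∣? _) ∘ generator-∣ S) (generator-∈ closed a ∘ T-does⁻ (_ ∣? _)))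

  principal-isIdeal : ∀ {d} → d ∣ N → T (isIdeal (principal d))
  principal-isIdeal {d} d∣N = T-∧⁺ has0 (T-∧⁺ add mul)
    where
    P = principal d
    has0 : T (any (λ a → (P ∋ a) ∧ isZeroElt a) (allFin N))
    has0 = any-allFin⁺ (λ a → (P ∋ a) ∧ isZeroElt a) zero (T-∧⁺ (principal-∋⁺ zero (d ∣0)) tt)
    sum∈ : ∀ a b → T ((P ∋ a) ∧ (P ∋ b)) → T (P ∋ addZ a b)
    sum∈ a b a∧b with T-∧⁻ {P ∋ a} a∧b
    ... | a∈ , b∈ = principal-∋⁺ (addZ a b) (subst (d ∣_) (sym (toℕ-addZ a b))
          (%-presˡ-∣ (∣m∣n⇒∣m+n (principal-∋⁻ a a∈) (principal-∋⁻ b b∈)) d∣N))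
    product∈ : ∀ r a → T (P ∋ a) → T (P ∋ mulZ r a)
    product∈ r a a∈ = principal-∋⁺ (mulZ r a) (subst (d ∣_) (sym (toℕ-mod (toℕ r * toℕ a)))
          (%-presˡ-∣ (∣-trans (principal-∋⁻ a a∈) (n∣m*n (toℕ r))) d∣N))
    add : T (all (λ a → all (λ b → not ((P ∋ a) ∧ (P ∋ b)) ∨ (P ∋ addZ a b)) (allFin N)) (allFin N))
    add = all-allFin⁺ (λ a → all (λ b → not ((P ∋ a) ∧ (P ∋ b)) ∨ (P ∋ addZ a b)) (allFin N)) λ a →
          all-allFin⁺ (λ b → not ((P ∋ a) ∧ (P ∋ b)) ∨ (P ∋ addZ a b)) λ b → T-implies⁺ (sum∈ a b)
    mul : T (all (λ r → all (λ a → not (P ∋ a) ∨ (P ∋ mulZ r a)) (allFin N)) (allFin N))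
    mul = all-allFin⁺ (λ r → all (λ a → not (P ∋ a) ∨ (P ∋ mulZ r a)) (allFin N)) λ r →
          all-allFin⁺ (λ a → not (P ∋ a) ∨ (P ∋ mulZ r a)) λ a → T-implies⁺ (product∈ r a)

  principal-∋-self : ∀ {d} → d < N → T (principal d ∋ (d mod N))
  principal-∋-self {d} d<N = principal-∋⁺ (d mod N) (subst (d ∣_) (sym (toℕ-mod-< d<N)) ∣-refl)

  principal-injective : ∀ {d e} → d < N → e < N → principal d ≡ principal e → d ≡ e
  principal-injective {d} {e} d<N e<N eq = ∣-antisym (divides-via eq e<N) (divides-via (sym eq) d<N)
    where
    divides-via : ∀ {d e} → principal d ≡ principal e → e < N → d ∣ e
    divides-via {d} {e} eq e<N = subst (d ∣_) (toℕ-mod-< e<N)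
      (principal-∋⁻ (e mod N) (subst (λ P → T (P ∋ (e mod N))) (sym eq) (principal-∋-self e<N)))

  Vertex : Set
  Vertex = Fin (numVertices N)

  gen : Vertex → ℕ
  gen i = generator (vertex N i)

  vertex≡principal : ∀ i → vertex N i ≡ principal (gen i)
  vertex≡principal i =
    closed⇒principal (isIdeal⇒Closed (proj₁ (vertex-valid N i)))

  vertex-∋⁺ : ∀ i a → gen i ∣ toℕ a → T (vertex N i ∋ a)
  vertex-∋⁺ i a = subst (λ S → T (S ∋ a)) (sym (vertex≡principal i)) ∘ principal-∋⁺ a

  vertex-∋⁻ : ∀ i a → T (vertex N i ∋ a) → gen i ∣ toℕ a
  vertex-∋⁻ i a = principal-∋⁻ a ∘ subst (λ S → T (S ∋ a)) (vertex≡principal i)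

  gen-∣N : ∀ i → gen i ∣ N
  gen-∣N i = generator-∣N (vertex N i)

  gen<N : ∀ i → gen i < N
  gen<N i = generator<N (vertex N i) (proj₁ (proj₂ (vertex-valid N i)))

  1<gen : ∀ i → 1 < gen i
  1<gen i = ≤∧≢⇒< (n≢0⇒n>0 gen≢0) (gen≢1 ∘ sym)
    where
    gen≢0 : gen i ≢ 0
    gen≢0 gen≡0 = 0≢1+n (sym (0∣⇒≡0 (subst (_∣ N) gen≡0 (gen-∣N i))))
    gen≢1 : gen i ≢ 1
    gen≢1 gen≡1 = proj₂ (proj₂ (vertex-valid N i))
      (all-allFin⁺ (vertex N i ∋_) λ a → vertex-∋⁺ i a (subst (_∣ toℕ a) (sym gen≡1) (1∣ toℕ a)))

  gen-injective : ∀ {i j} → gen i ≡ gen j → i ≡ j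
  gen-injective {i} {j} eq =
    vertex-injective N (trans (vertex≡principal i) (trans (cong principal eq) (sym (vertex≡principal j))))

  divisor⇒vertex : ∀ {d} → d ∣ N → 1 < d → d < N → ∃ λ i → gen i ≡ d
  divisor⇒vertex {d} d∣N 1<d d<N =
    let i , vertex≡ = vertex-surjective (∈-vertices⁺ (principal-isIdeal d∣N) nonzero proper)
    in i , principal-injective (gen<N i) d<N (trans (sym (vertex≡principal i)) vertex≡)
    where
    nonzero : ¬ T (isZeroSet (principal d))
    nonzero zeroSet = <⇒≢ (<-trans z<s 1<d)
      (sym (trans (sym (toℕ-mod-< d<N)) (isZeroSet⁻ (principal d) zeroSet (principal-∋-self d<N))))
    proper : ¬ T (isFull (principal d))
    proper full = <⇒≢ 1<d (sym (∣1⇒≡1 (subst (d ∣_) (toℕ-mod-< (<-trans 1<d d<N))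
      (principal-∋⁻ (1 mod N) (isFull⁻ (principal d) full (1 mod N))))))

-- Essential sums of vertices

module EssentialIdeals (m : ℕ) {k : ℕ} {ps ms : Fin k → ℕ} (F : Factorisation (suc m) ps ms) where
  open Ideals m
  open FactorisationProperties F
  open Factorisation F using (prime)

  -- N/pₗ generates a minimal ideal; every nonzero ideal contains one of them.
  atom : Fin k → Fin N
  atom l = N/p l mod N

  toℕ-atom : ∀ l → toℕ (atom l) ≡ N/p l
  toℕ-atom l = toℕ-mod-< (N/p<N l)

  toℕ-atom≢0 : ∀ l → toℕ (atom l) ≢ 0
  toℕ-atom≢0 l = subst (_≢ 0) (sym (toℕ-atom l)) (n>0⇒n≢0 (0<N/p l))

  ∩-∋ : ∀ (X J : Subset N) a → (X ∩ J) ∋ a ≡ (X ∋ a) ∧ (J ∋ a)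
  ∩-∋ X J a = lookup-zipWith _∧_ a X J

  essential⁺ : ∀ X → (∀ l → T (X ∋ atom l)) → T (isEssential X)
  essential⁺ X atom∈X = all⁻ (λ J → isZeroSet J ∨ not (isZeroSet (X ∩ J))) {ideals N} (All.tabulate meets)
    where
    meets : ∀ {J} → J ∈ ideals N → T (isZeroSet J ∨ not (isZeroSet (X ∩ J)))
    meets {J} J∈ = T-∨-not⁺ λ nonzero zero∩ →
      let closed = isIdeal⇒Closed {J} (∈-ideals⁻ {S = J} J∈)
          l , g∣N/p = proper-divisor⇒∣N/p (generator-∣N J) (generator<N J nonzero)
          atom∈J = generator-∈ closed (atom l) (subst (generator J ∣_) (sym (toℕ-atom l)) g∣N/p)
      in toℕ-atom≢0 l
           (isZeroSet⁻ (X ∩ J) zero∩ (subst T (sym (∩-∋ X J (atom l))) (T-∧⁺ (atom∈X l) atom∈J)))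

  essential⁻ : ∀ X → T (isEssential X) → ∀ l → ∃ λ y → T (X ∋ y) × N/p l ∣ toℕ y × toℕ y ≢ 0
  essential⁻ X essential l with ¬isZeroSet⁻ (X ∩ J) (T-∨-not⁻ meets nonzero)
    where
    J = principal (N/p l)
    meets : T (isZeroSet J ∨ not (isZeroSet (X ∩ J)))
    meets = All.lookup (all⁺ (λ J → isZeroSet J ∨ not (isZeroSet (X ∩ J))) (ideals N) essential)
                       (∈-ideals⁺ (principal-isIdeal (N/p∣N l)))
    nonzero : ¬ T (isZeroSet J)
    nonzero zeroSet = toℕ-atom≢0 l
      (isZeroSet⁻ J zeroSet (principal-∋⁺ (atom l) (subst (N/p l ∣_) (sym (toℕ-atom l)) ∣-refl)))
  ... | y , y∈X∩J , y≢0 with T-∧⁻ {X ∋ y} (subst T (∩-∋ X (principal (N/p l)) y) y∈X∩J)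
  ...   | y∈X , y∈J = y , y∈X , principal-∋⁻ y y∈J , y≢0

  sumIdeal-member : Subset N → Subset N → Fin N → Bool
  sumIdeal-member I K x =
    any (λ a → any (λ b → (I ∋ a) ∧ (K ∋ b) ∧ eqᵇ (addZ a b) x) (allFin N)) (allFin N)

  sumIdeal-∋⁺ : ∀ (I K : Subset N) a b → T (I ∋ a) → T (K ∋ b) → T (sumIdeal I K ∋ addZ a b)
  sumIdeal-∋⁺ I K a b a∈ b∈ = subst T (sym (lookup∘tabulate (sumIdeal-member I K) (addZ a b)))
    (any-allFin⁺ (λ a′ → any (λ b′ → (I ∋ a′) ∧ (K ∋ b′) ∧ eqᵇ (addZ a′ b′) (addZ a b)) (allFin N)) a
      (any-allFin⁺ (λ b′ → (I ∋ a) ∧ (K ∋ b′) ∧ eqᵇ (addZ a b′) (addZ a b)) b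
        (T-∧⁺ a∈ (T-∧⁺ b∈ (T-does⁺ (addZ a b Fin.≟ addZ a b) refl)))))

  sumIdeal-∋⁻ : ∀ (I K : Subset N) x → T (sumIdeal I K ∋ x) →
                ∃ λ a → ∃ λ b → T (I ∋ a) × T (K ∋ b) × addZ a b ≡ x
  sumIdeal-∋⁻ I K x x∈
    with any-allFin⁻ (λ a → any (λ b → (I ∋ a) ∧ (K ∋ b) ∧ eqᵇ (addZ a b) x) (allFin N))
                     (subst T (lookup∘tabulate (sumIdeal-member I K) x) x∈)
  ... | a , ∃b with any-allFin⁻ (λ b → (I ∋ a) ∧ (K ∋ b) ∧ eqᵇ (addZ a b) x) ∃b
  ...   | b , a∈∧b∈∧eq with T-∧⁻ {I ∋ a} a∈∧b∈∧eq
  ...     | a∈ , b∈∧eq with T-∧⁻ {K ∋ b} b∈∧eq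
  ...       | b∈ , eq = a , b , a∈ , b∈ , T-does⁻ (addZ a b Fin.≟ x) eq

  atom∈vertex : ∀ i l → ¬ pw l ∣ gen i → T (vertex N i ∋ atom l)
  atom∈vertex i l pw∤g =
    vertex-∋⁺ i (atom l) (subst (gen i ∣_) (sym (toℕ-atom l)) (pw∤⇒∣N/p l (gen-∣N i) pw∤g))

  essential-sum⁺ : ∀ i j → (∀ l → ¬ (pw l ∣ gen i × pw l ∣ gen j)) →
                   T (isEssential (sumIdeal (vertex N i) (vertex N j)))
  essential-sum⁺ i j coprime = essential⁺ X atom∈sum
    where
    X = sumIdeal (vertex N i) (vertex N j)
    atom∈sum : ∀ l → T (X ∋ atom l)
    atom∈sum l with pw l ∣? gen i | pw l ∣? gen j
    ... | no pw∤gi | _ = subst (T ∘ (X ∋_)) (addZ-identityʳ (atom l))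
      (sumIdeal-∋⁺ (vertex N i) (vertex N j) (atom l) zero (atom∈vertex i l pw∤gi) (vertex-∋⁺ j zero (gen j ∣0)))
    ... | yes _ | no pw∤gj = subst (T ∘ (X ∋_)) (addZ-identityˡ (atom l))
      (sumIdeal-∋⁺ (vertex N i) (vertex N j) zero (atom l) (vertex-∋⁺ i zero (gen i ∣0)) (atom∈vertex j l pw∤gj))
    ... | yes pw∣gi | yes pw∣gj = ⊥-elim (coprime l (pw∣gi , pw∣gj))

  sumIdeal-vertex-∣ : ∀ i j y {d} → d ∣ N → d ∣ gen i → d ∣ gen j →
                      T (sumIdeal (vertex N i) (vertex N j) ∋ y) → d ∣ toℕ y
  sumIdeal-vertex-∣ i j y {d} d∣N d∣gi d∣gj y∈ =
    let a , b , a∈ , b∈ , a+b≡y = sumIdeal-∋⁻ (vertex N i) (vertex N j) y y∈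
    in subst (λ z → d ∣ toℕ z) a+b≡y (subst (d ∣_) (sym (toℕ-addZ a b))
         (%-presˡ-∣ (∣m∣n⇒∣m+n (∣-trans d∣gi (vertex-∋⁻ i a a∈)) (∣-trans d∣gj (vertex-∋⁻ j b b∈)))
                    d∣N))

  essential-sum⁻ : ∀ i j → T (isEssential (sumIdeal (vertex N i) (vertex N j))) →
                   ∀ l → ¬ (pw l ∣ gen i × pw l ∣ gen j)
  essential-sum⁻ i j essential l (pw∣gi , pw∣gj) =
    let y , y∈ , N/p∣y , y≢0 = essential⁻ (sumIdeal (vertex N i) (vertex N j)) essential l
    in pw∤multiple-of-N/p l (n≢0⇒n>0 y≢0) (toℕ<n y) N/p∣y
         (sumIdeal-vertex-∣ i j y (pw∣N l) pw∣gi pw∣gj y∈)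

  Adjacent : Vertex → Vertex → Set
  Adjacent i j = i ≢ j × ∀ l → ¬ (pw l ∣ gen i × pw l ∣ gen j)

  adjacent⇔ : ∀ i j → T (adjacent N i j) ⇔ Adjacent i j
  adjacent⇔ i j = mk⇔
    (λ adj → let i≢j , essential = T-∧⁻ {not (eqᵇ i j)} adj
             in T-not⁻ i≢j ∘ T-does⁺ (i Fin.≟ j) , essential-sum⁻ i j essential)
    (λ (i≢j , coprime) → T-∧⁺ (T-not⁺ (i≢j ∘ T-does⁻ (i Fin.≟ j))) (essential-sum⁺ i j coprime))

  equal-pw-divisors⇒twins : ∀ {a b} → (∀ l → pw l ∣ gen a → pw l ∣ gen b) →
                            (∀ l → pw l ∣ gen b → pw l ∣ gen a) →
                            (∃ λ l → pw l ∣ gen a) → ∀ r → adjacent N r a ≡ adjacent N r b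
  equal-pw-divisors⇒twins {a} {b} a⇒b b⇒a (l , pw∣ga) r = T-injective
    (Equivalence.from (adjacent⇔ r b) ∘ a-to-b ∘ Equivalence.to (adjacent⇔ r a))
    (Equivalence.from (adjacent⇔ r a) ∘ b-to-a ∘ Equivalence.to (adjacent⇔ r b))
    where
    a-to-b : Adjacent r a → Adjacent r b
    a-to-b (r≢a , coprime) = (λ { refl → coprime l (a⇒b l pw∣ga , pw∣ga) }) ,
                             λ l′ (pw∣gr , pw∣gb) → coprime l′ (pw∣gr , b⇒a l′ pw∣gb)
    b-to-a : Adjacent r b → Adjacent r a
    b-to-a (r≢b , coprime) = (λ { refl → coprime l (pw∣ga , a⇒b l pw∣ga) }) ,
                             λ l′ (pw∣gr , pw∣ga′) → coprime l′ (pw∣gr , a⇒b l′ pw∣ga′)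

sumℚ-cong : ∀ n {f g : Fin n → ℚ} → (∀ j → f j ≡ g j) → sumℚ n f ≡ sumℚ n g
sumℚ-cong zero _ = refl
sumℚ-cong (suc n) f≗g = cong₂ ℚ._+_ (f≗g zero) (sumℚ-cong n (f≗g ∘ suc))

sumℚ-zero : ∀ n (f : Fin n → ℚ) → (∀ j → f j ≡ 0ℚ) → sumℚ n f ≡ 0ℚ
sumℚ-zero n f f≗0 = trans (sumℚ-cong n f≗0) (sumℚ-0 n)
  where
  sumℚ-0 : ∀ n → sumℚ n (λ _ → 0ℚ) ≡ 0ℚ
  sumℚ-0 zero = refl
  sumℚ-0 (suc n) = trans (ℚ.+-identityˡ _) (sumℚ-0 n)

sumℚ-single : ∀ n (f : Fin n → ℚ) v → (∀ j → j ≢ v → f j ≡ 0ℚ) → sumℚ n f ≡ f v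
sumℚ-single (suc n) f zero vanish =
  trans (cong (f zero ℚ.+_) (sumℚ-zero n (f ∘ suc) λ j → vanish (suc j) λ ())) (ℚ.+-identityʳ (f zero))
sumℚ-single (suc n) f (suc v) vanish =
  trans (cong (ℚ._+ sumℚ n (f ∘ suc)) (vanish zero λ ()))
        (trans (ℚ.+-identityˡ _)
               (sumℚ-single n (f ∘ suc) v λ j j≢v → vanish (suc j) (j≢v ∘ Finₚ.suc-injective)))

sumℚ-pair : ∀ n (f : Fin n → ℚ) a b → a ≢ b → (∀ j → j ≢ a → j ≢ b → f j ≡ 0ℚ) →
            sumℚ n f ≡ f a ℚ.+ f b
sumℚ-pair (suc n) f zero zero a≢b _ = ⊥-elim (a≢b refl)
sumℚ-pair (suc n) f zero (suc b) _ vanish =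
  cong (f zero ℚ.+_) (sumℚ-single n (f ∘ suc) b λ j j≢b → vanish (suc j) (λ ()) (j≢b ∘ Finₚ.suc-injective))
sumℚ-pair (suc n) f (suc a) zero _ vanish =
  trans (cong (f zero ℚ.+_)
              (sumℚ-single n (f ∘ suc) a λ j j≢a → vanish (suc j) (j≢a ∘ Finₚ.suc-injective) (λ ())))
        (ℚ.+-comm (f zero) (f (suc a)))
sumℚ-pair (suc n) f (suc a) (suc b) a≢b vanish =
  trans (cong (ℚ._+ sumℚ n (f ∘ suc)) (vanish zero (λ ()) (λ ())))
        (trans (ℚ.+-identityˡ _) (sumℚ-pair n (f ∘ suc) a b (a≢b ∘ cong suc)
          λ j j≢a j≢b → vanish (suc j) (j≢a ∘ Finₚ.suc-injective) (j≢b ∘ Finₚ.suc-injective)))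

sumℚ-update : ∀ n (f g : Fin n → ℚ) v → (∀ j → j ≢ v → f j ≡ g j) →
              sumℚ n f ℚ.+ g v ≡ sumℚ n g ℚ.+ f v
sumℚ-update (suc n) f g zero agree = begin
  (f zero ℚ.+ sumℚ n (f ∘ suc)) ℚ.+ g zero ≡⟨ xy∙z≈zy∙x (f zero) _ (g zero) ⟩
  (g zero ℚ.+ sumℚ n (f ∘ suc)) ℚ.+ f zero ≡⟨ cong (λ s → (g zero ℚ.+ s) ℚ.+ f zero)
                                                   (sumℚ-cong n λ j → agree (suc j) λ ()) ⟩
  (g zero ℚ.+ sumℚ n (g ∘ suc)) ℚ.+ f zero ∎
  where open ≡-Reasoning
sumℚ-update (suc n) f g (suc v) agree = begin
  (f zero ℚ.+ sumℚ n (f ∘ suc)) ℚ.+ g (suc v) ≡⟨ ℚ.+-assoc (f zero) _ _ ⟩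
  f zero ℚ.+ (sumℚ n (f ∘ suc) ℚ.+ g (suc v)) ≡⟨ cong₂ ℚ._+_ (agree zero λ ())
                                                   (sumℚ-update n (f ∘ suc) (g ∘ suc) v λ j j≢v →
                                                      agree (suc j) (j≢v ∘ Finₚ.suc-injective)) ⟩
  g zero ℚ.+ (sumℚ n (g ∘ suc) ℚ.+ f (suc v)) ≡⟨ ℚ.+-assoc (g zero) _ _ ⟨
  (g zero ℚ.+ sumℚ n (g ∘ suc)) ℚ.+ f (suc v) ∎
  where open ≡-Reasoning

sumℚ-*ʳ : ∀ n (f : Fin n → ℚ) s → sumℚ n (λ j → f j ℚ.* s) ≡ sumℚ n f ℚ.* s
sumℚ-*ʳ zero f s = sym (ℚ.*-zeroˡ s)
sumℚ-*ʳ (suc n) f s =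
  trans (cong (f zero ℚ.* s ℚ.+_) (sumℚ-*ʳ n (f ∘ suc) s)) (sym (ℚ.*-distribʳ-+ s (f zero) _))

sumℚ-nonNegative : ∀ n (f : Fin n → ℚ) → (∀ j → 0ℚ ℚ.≤ f j) → 0ℚ ℚ.≤ sumℚ n f
sumℚ-nonNegative zero f _ = ℚ.≤-refl
sumℚ-nonNegative (suc n) f f≥0 = ℚ.+-mono-≤ (f≥0 zero) (sumℚ-nonNegative n (f ∘ suc) (f≥0 ∘ suc))

sumℚ-≥-term : ∀ n (f : Fin n → ℚ) → (∀ j → 0ℚ ℚ.≤ f j) → ∀ v → f v ℚ.≤ sumℚ n f
sumℚ-≥-term (suc n) f f≥0 zero =
  subst (ℚ._≤ sumℚ (suc n) f) (ℚ.+-identityʳ (f zero))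
        (ℚ.+-mono-≤ (ℚ.≤-refl {f zero}) (sumℚ-nonNegative n (f ∘ suc) (f≥0 ∘ suc)))
sumℚ-≥-term (suc n) f f≥0 (suc v) =
  subst (ℚ._≤ sumℚ (suc n) f) (ℚ.+-identityˡ (f (suc v)))
        (ℚ.+-mono-≤ (f≥0 zero) (sumℚ-≥-term n (f ∘ suc) (f≥0 ∘ suc) v))

*-cancel-≢0 : ∀ t s → t ≢ 0ℚ → t ℚ.* s ≡ 0ℚ → s ≡ 0ℚ
*-cancel-≢0 t s t≢0 ts≡0 = begin
  s                 ≡⟨ ℚ.*-identityˡ s ⟨
  1ℚ ℚ.* s          ≡⟨ cong (ℚ._* s) (ℚ.*-inverseˡ t) ⟨
  (t⁻¹ ℚ.* t) ℚ.* s ≡⟨ ℚ.*-assoc t⁻¹ t s ⟩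
  t⁻¹ ℚ.* (t ℚ.* s) ≡⟨ cong (t⁻¹ ℚ.*_) ts≡0 ⟩
  t⁻¹ ℚ.* 0ℚ        ≡⟨ ℚ.*-zeroʳ t⁻¹ ⟩
  0ℚ                ∎
  where
  open ≡-Reasoning
  instance
    t-nonZero : ℚ.NonZero t
    t-nonZero = ℚ.≢-nonZero t≢0
  t⁻¹ = ℚ.1/ t

adjacencyMatrix : ∀ {n} → (Fin n → Fin n → Bool) → Fin n → Fin n → ℚ
adjacencyMatrix adj i j = if adj i j then 1ℚ else 0ℚ

module Spectrum {n : ℕ} (adj : Fin n → Fin n → Bool) where

  A = adjacencyMatrix adj

  A-edge : ∀ {i j} → T (adj i j) → A i j ≡ 1ℚ
  A-edge {i} {j} _ with adj i j
  ... | true = refl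

  A-nonedge : ∀ {i j} → ¬ T (adj i j) → A i j ≡ 0ℚ
  A-nonedge {i} {j} ¬edge with adj i j
  ... | true = ⊥-elim (¬edge tt)
  ... | false = refl

  A-nonNegative : ∀ i j → 0ℚ ℚ.≤ A i j
  A-nonNegative i j with adj i j
  ... | true = ℚ.*≤* (ℤ.+≤+ z≤n)
  ... | false = ℚ.≤-refl

  edgeless⇒zeroEigenvalue : Fin n → (∀ i j → ¬ T (adj i j)) → ZeroIsEigenvalue n A
  edgeless⇒zeroEigenvalue v edgeless = (λ _ → 1ℚ) , (λ all0 → ℚ.1≢0 (all0 v)) , λ i →
    sumℚ-zero n _ λ j → trans (cong (ℚ._* 1ℚ) (A-nonedge (edgeless i j))) (ℚ.*-zeroˡ 1ℚ)

  twins⇒zeroEigenvalue : ∀ a b → a ≢ b → (∀ r → adj r a ≡ adj r b) → ZeroIsEigenvalue n A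
  twins⇒zeroEigenvalue a b a≢b twins = x , (λ all0 → ℚ.1≢0 (trans (sym x-a) (all0 a))) , row
    where
    x : Fin n → ℚ
    x j = if does (j Fin.≟ a) then 1ℚ else if does (j Fin.≟ b) then ℚ.- 1ℚ else 0ℚ
    x-a : x a ≡ 1ℚ
    x-a with a Fin.≟ a
    ... | yes _ = refl
    ... | no a≢a = ⊥-elim (a≢a refl)
    x-b : x b ≡ ℚ.- 1ℚ
    x-b with b Fin.≟ a | b Fin.≟ b
    ... | yes b≡a | _ = ⊥-elim (a≢b (sym b≡a))
    ... | no _ | yes _ = refl
    ... | no _ | no b≢b = ⊥-elim (b≢b refl)
    x-else : ∀ j → j ≢ a → j ≢ b → x j ≡ 0ℚ
    x-else j j≢a j≢b with j Fin.≟ a | j Fin.≟ b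
    ... | yes j≡a | _ = ⊥-elim (j≢a j≡a)
    ... | no _ | yes j≡b = ⊥-elim (j≢b j≡b)
    ... | no _ | no _ = refl
    cancels : ∀ r → A r a ℚ.* 1ℚ ℚ.+ A r b ℚ.* ℚ.- 1ℚ ≡ 0ℚ
    cancels r rewrite twins r with adj r b
    ... | true = refl
    ... | false = refl
    row : ∀ r → sumℚ n (λ j → A r j ℚ.* x j) ≡ 0ℚ
    row r = begin
      sumℚ n (λ j → A r j ℚ.* x j)         ≡⟨ sumℚ-pair n _ a b a≢b other-terms ⟩
      A r a ℚ.* x a ℚ.+ A r b ℚ.* x b      ≡⟨ cong₂ (λ u w → A r a ℚ.* u ℚ.+ A r b ℚ.* w) x-a x-b ⟩
      A r a ℚ.* 1ℚ ℚ.+ A r b ℚ.* ℚ.- 1ℚ    ≡⟨ cancels r ⟩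
      0ℚ                                   ∎
      where
      open ≡-Reasoning
      other-terms : ∀ j → j ≢ a → j ≢ b → A r j ℚ.* x j ≡ 0ℚ
      other-terms j j≢a j≢b = trans (cong (A r j ℚ.*_) (x-else j j≢a j≢b)) (ℚ.*-zeroʳ (A r j))

  -- Row i of A x = 0 says x i = Σ x; row a then gives deg(a) · Σ x = 0 with deg(a) ≥ 1.
  complete⇒¬zeroEigenvalue : ∀ {a b} → a ≢ b → (∀ i j → i ≢ j → T (adj i j)) → (∀ i → ¬ T (adj i i)) →
                             ¬ ZeroIsEigenvalue n A
  complete⇒¬zeroEigenvalue {a} {b} a≢b edge loopless (x , x≢0 , row) = x≢0 λ i → trans (x≡S i) S≡0
    where
    S = sumℚ n x
    x≡S : ∀ i → x i ≡ S
    x≡S i = begin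
      x i                                   ≡⟨ ℚ.+-identityˡ (x i) ⟨
      0ℚ ℚ.+ x i                            ≡⟨ cong (ℚ._+ x i) (row i) ⟨
      sumℚ n (λ j → A i j ℚ.* x j) ℚ.+ x i  ≡⟨ sumℚ-update n _ x i off-diagonal ⟩
      S ℚ.+ A i i ℚ.* x i                   ≡⟨ cong (λ q → S ℚ.+ q ℚ.* x i) (A-nonedge (loopless i)) ⟩
      S ℚ.+ 0ℚ ℚ.* x i                      ≡⟨ cong (S ℚ.+_) (ℚ.*-zeroˡ (x i)) ⟩
      S ℚ.+ 0ℚ                              ≡⟨ ℚ.+-identityʳ S ⟩
      S                                     ∎
      where
      open ≡-Reasoning
      off-diagonal : ∀ j → j ≢ i → A i j ℚ.* x j ≡ x j
      off-diagonal j j≢i = trans (cong (ℚ._* x j) (A-edge (edge i j (j≢i ∘ sym)))) (ℚ.*-identityˡ (x j))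
    degree = sumℚ n (A a)
    degree≢0 : degree ≢ 0ℚ
    degree≢0 degree≡0 = ℚ.<-irrefl refl (ℚ.<-≤-trans 0<1 (subst (1ℚ ℚ.≤_) degree≡0
      (subst (ℚ._≤ degree) (A-edge (edge a b a≢b)) (sumℚ-≥-term n (A a) (A-nonNegative a) b))))
      where
      0<1 : 0ℚ ℚ.< 1ℚ
      0<1 = ℚ.*<* (ℤ.+<+ z<s)
    S≡0 : S ≡ 0ℚ
    S≡0 = *-cancel-≢0 degree S degree≢0
      (trans (sym (sumℚ-*ʳ n (A a) S)) (trans (sumℚ-cong n λ j → cong (A a j ℚ.*_) (sym (x≡S j))) (row a)))

  -- Row (partner v) of A x = 0 reduces to x v = 0 once x vanishes on vertices of smaller h.
  partnered⇒¬zeroEigenvalue : (h : Fin n → ℕ) (partner : Fin n → Fin n) →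
                              (∀ v → T (adj (partner v) v)) →
                              (∀ v j → T (adj (partner v) j) → j ≢ v → h j < h v) →
                              ¬ ZeroIsEigenvalue n A
  partnered⇒¬zeroEigenvalue h partner partnered lower (x , x≢0 , row) = x≢0 λ v → vanish (suc (h v)) v ≤-refl
    where
    vanish : ∀ bound v → h v < bound → x v ≡ 0ℚ
    vanish (suc bound) v hv<bound = begin
      x v                                        ≡⟨ ℚ.*-identityˡ (x v) ⟨
      1ℚ ℚ.* x v                                 ≡⟨ cong (ℚ._* x v) (A-edge (partnered v)) ⟨
      A (partner v) v ℚ.* x v                    ≡⟨ sumℚ-single n _ v other-terms ⟨
      sumℚ n (λ j → A (partner v) j ℚ.* x j)     ≡⟨ row (partner v) ⟩
      0ℚ                                         ∎
      where
      open ≡-Reasoning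
      other-terms : ∀ j → j ≢ v → A (partner v) j ℚ.* x j ≡ 0ℚ
      other-terms j j≢v with T? (adj (partner v) j)
      ... | yes edge = trans (cong (A (partner v) j ℚ.*_) (vanish bound j hj<bound)) (ℚ.*-zeroʳ (A (partner v) j))
        where hj<bound = <-≤-trans (lower v j edge j≢v) (s≤s⁻¹ hv<bound)
      ... | no ¬edge = trans (cong (ℚ._* x j) (A-nonedge ¬edge)) (ℚ.*-zeroˡ (x j))


-- The four cases

Nonsingular : ℕ → Set
Nonsingular N = ¬ ZeroIsEigenvalue (numVertices N) (adjMatrix N)

module Squarefree (m : ℕ) {k : ℕ} {ps ms : Fin k → ℕ} (F : Factorisation (suc m) ps ms)
                  (squarefree : ∀ l → ms l ≡ 1) where
  open Ideals m
  open FactorisationProperties F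
  open EssentialIdeals m F
  open Factorisation F using (prime; primeDivisor)
  open Spectrum (adjacent N)

  pw≡p : ∀ l → pw l ≡ ps l
  pw≡p l rewrite squarefree l = *-identityʳ (ps l)

  p²∤N : ∀ l → ¬ ps l * ps l ∣ N
  p²∤N l p²∣N = pw∤N/p l (subst (_∣ N/p l) (sym (pw≡p l))
    (*-cancelˡ-∣ (ps l) (subst (ps l * ps l ∣_) (N≡p*N/p l) p²∣N)))

  complement : Vertex → ℕ
  complement v = _∣_.quotient (gen-∣N v)

  N≡complement*gen : ∀ v → N ≡ complement v * gen v
  N≡complement*gen v = _∣_.equality (gen-∣N v)

  complement∣N : ∀ v → complement v ∣ N
  complement∣N v = divides (gen v) (trans (N≡complement*gen v) (*-comm (complement v) (gen v)))

  1<complement : ∀ v → 1 < complement v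
  1<complement v = ≤∧≢⇒< (n≢0⇒n>0 c≢0) c≢1
    where
    c≢0 : complement v ≢ 0
    c≢0 c≡0 = 0≢1+n (sym (trans (N≡complement*gen v) (cong (_* gen v) c≡0)))
    c≢1 : 1 ≢ complement v
    c≢1 1≡c = <⇒≢ (gen<N v)
      (sym (trans (N≡complement*gen v) (trans (cong (_* gen v) (sym 1≡c)) (*-identityˡ (gen v)))))

  complement<N : ∀ v → complement v < N
  complement<N v = subst (complement v <_) (sym (N≡complement*gen v))
    (m<m*n (complement v) (gen v) {{>-nonZero (<-trans z<s (1<complement v))}} (1<gen v))

  partner : Vertex → Vertex
  partner v = proj₁ (divisor⇒vertex (complement∣N v) (1<complement v) (complement<N v))

  gen-partner : ∀ v → gen (partner v) ≡ complement v
  gen-partner v = proj₂ (divisor⇒vertex (complement∣N v) (1<complement v) (complement<N v))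

  complement-coprime : ∀ v l → ¬ (ps l ∣ complement v × ps l ∣ gen v)
  complement-coprime v l (p∣c , p∣g) =
    p²∤N l (subst (ps l * ps l ∣_) (sym (N≡complement*gen v)) (*-pres-∣ p∣c p∣g))

  partner-adjacent : ∀ v → Adjacent (partner v) v
  partner-adjacent v = partner≢ , coprime
    where
    coprime : ∀ l → ¬ (pw l ∣ gen (partner v) × pw l ∣ gen v)
    coprime l (pw∣gu , pw∣gv) = complement-coprime v l
      (subst₂ _∣_ (pw≡p l) (gen-partner v) pw∣gu , subst (_∣ gen v) (pw≡p l) pw∣gv)
    partner≢ : partner v ≢ v
    partner≢ u≡v =
      let q , q-prime , q∣g = prime-divisor (1<gen v)
          l , q≡p = primeDivisor q-prime (∣-trans q∣g (gen-∣N v))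
          p∣g = subst (_∣ gen v) q≡p q∣g
      in complement-coprime v l (subst (ps l ∣_) (trans (sym (cong gen u≡v)) (gen-partner v)) p∣g , p∣g)

  partner-neighbour-∣ : ∀ v j → Adjacent (partner v) j → gen j ∣ gen v
  partner-neighbour-∣ v j (_ , coprime) = coprime-divisor gj-coprime
    (subst (gen j ∣_) (N≡complement*gen v) (gen-∣N j))
    where
    gj-coprime : Coprime (gen j) (complement v)
    gj-coprime = no-common-prime⇒coprime {{>-nonZero (<-trans z<s (1<gen j))}} λ q-prime q∣gj q∣c →
      let l , q≡p = primeDivisor q-prime (∣-trans q∣gj (gen-∣N j))
      in coprime l (subst₂ _∣_ (trans q≡p (sym (pw≡p l))) (sym (gen-partner v)) q∣c ,
                    subst (_∣ gen j) (trans q≡p (sym (pw≡p l))) q∣gj)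

  nonsingular : Nonsingular N
  nonsingular = partnered⇒¬zeroEigenvalue gen partner
    (λ v → Equivalence.from (adjacent⇔ (partner v) v) (partner-adjacent v))
    λ v j edge j≢v → ≤∧≢⇒< (∣⇒≤ {{>-nonZero (<-trans z<s (1<gen v))}} (gj∣gv v j edge)) (j≢v ∘ gen-injective)
    where
    gj∣gv : ∀ v j → T (adjacent N (partner v) j) → gen j ∣ gen v
    gj∣gv v j edge = partner-neighbour-∣ v j (Equivalence.to (adjacent⇔ (partner v) j) edge)

module PrimePower (m : ℕ) {ps ms : Fin 1 → ℕ} (F : Factorisation (suc m) ps ms) where
  open Ideals m
  open FactorisationProperties F
  open EssentialIdeals m F
  open Factorisation F using (prime; primeDivisor; cofactor; split; ∤cofactor)
  open Spectrum (adjacent N)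

  Fin1-zero : ∀ (l : Fin 1) → l ≡ zero
  Fin1-zero zero = refl

  p : ℕ
  p = ps zero

  1<p : 1 < p
  1<p = nonTrivial⇒n>1 p {{prime⇒nonTrivial (prime zero)}}

  cofactor≡1 : cofactor zero ≡ 1
  cofactor≡1 = no-prime-divisor⇒≡1 cofactor≢0 λ q-prime q∣c →
    let l , q≡p = primeDivisor q-prime (∣-trans q∣c (divides (pw zero) (split zero)))
    in ∤cofactor zero (subst (_∣ cofactor zero) (trans q≡p (cong ps (Fin1-zero l))) q∣c)
    where
    cofactor≢0 : cofactor zero ≢ 0
    cofactor≢0 c≡0 = 0≢1+n (sym (trans (split zero) (trans (cong (pw zero *_) c≡0) (*-zeroʳ (pw zero)))))

  N≡p^e : N ≡ p ^ ms zero
  N≡p^e = trans (split zero) (trans (cong (pw zero *_) cofactor≡1) (*-identityʳ (pw zero)))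

  gen∣N/p : ∀ i → gen i ∣ N/p zero
  gen∣N/p i = let l , g∣N/p = proper-divisor⇒∣N/p (gen-∣N i) (gen<N i)
              in subst (λ l → gen i ∣ N/p l) (Fin1-zero l) g∣N/p

  loopless : ∀ i → ¬ T (adjacent N i i)
  loopless i = (λ i≢i → i≢i refl) ∘ proj₁ ∘ Equivalence.to (adjacent⇔ i i)

  distinct⇒adjacent : ∀ i j → i ≢ j → T (adjacent N i j)
  distinct⇒adjacent i j i≢j = Equivalence.from (adjacent⇔ i j)
    (i≢j , λ { zero (pw∣gi , _) → pw∣⇒∤N/p zero pw∣gi (gen∣N/p i) })

  cube⇒nonsingular : 2 < ms zero → Nonsingular N
  cube⇒nonsingular 2<e = complete⇒¬zeroEigenvalue a≢b distinct⇒adjacent loopless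
    where
    p²∣N = subst (p * p ∣_) (sym N≡p^e) (n*n∣n^m p (<⇒≤ 2<e))
    p²<N = subst (p * p <_) (sym N≡p^e) (n*n<n^m 1<p 2<e)
    p<p² = m<m*n p p {{>-nonZero (<-trans z<s 1<p)}} 1<p
    vertex-p : ∃ λ a → gen a ≡ p
    vertex-p = divisor⇒vertex (p∣N zero) 1<p (<-trans p<p² p²<N)
    vertex-p² : ∃ λ b → gen b ≡ p * p
    vertex-p² = divisor⇒vertex p²∣N (<-trans 1<p p<p²) p²<N
    a≢b : proj₁ vertex-p ≢ proj₁ vertex-p²
    a≢b a≡b = <⇒≢ p<p² (trans (sym (proj₂ vertex-p)) (trans (cong gen a≡b) (proj₂ vertex-p²)))

  square⇒zeroEigenvalue : ms zero ≡ 2 → ZeroIsEigenvalue (numVertices N) (adjMatrix N)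
  square⇒zeroEigenvalue e≡2 = edgeless⇒zeroEigenvalue v edgeless
    where
    N/p≡p : N/p zero ≡ p
    N/p≡p rewrite e≡2 | cofactor≡1 = trans (*-identityʳ (p * 1)) (*-identityʳ p)
    p<N : p < N
    p<N = subst (p <_) (trans (cong (p *_) (sym N/p≡p)) (sym (N≡p*N/p zero)))
                (m<m*n p p {{>-nonZero (<-trans z<s 1<p)}} 1<p)
    v : Vertex
    v = proj₁ (divisor⇒vertex (p∣N zero) 1<p p<N)
    gen≡p : ∀ i → gen i ≡ p
    gen≡p i = [ (λ gen≡1 → ⊥-elim (<⇒≢ (1<gen i) (sym gen≡1))) , id ]′
                (prime⇒irreducible (prime zero) (subst (gen i ∣_) N/p≡p (gen∣N/p i)))
    edgeless : ∀ i j → ¬ T (adjacent N i j)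
    edgeless i j = (λ i≢j → i≢j (gen-injective (trans (gen≡p i) (sym (gen≡p j)))))
                 ∘ proj₁ ∘ Equivalence.to (adjacent⇔ i j)

module TwinVertices (m : ℕ) {k : ℕ} {ps ms : Fin k → ℕ} (F : Factorisation (suc m) ps ms)
                    {i j : Fin k} (i≢j : i ≢ j) (2≤mᵢ : 2 ≤ ms i) where
  open Ideals m
  open FactorisationProperties F
  open EssentialIdeals m F
  open Factorisation F using (prime; injective; exponent≥1; cofactor; split)
  open Spectrum (adjacent N)

  p∤pw : ∀ {l l′} → l ≢ l′ → ¬ ps l ∣ pw l′
  p∤pw {l} {l′} l≢l′ p∣pw =
    l≢l′ (injective (prime∣prime⇒≡ (prime l) (prime l′) (prime∣^⇒∣ (ms l′) (prime l) p∣pw)))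

  p∣pw : ∀ l → ps l ∣ pw l
  p∣pw l = n∣n^m (ps l) (exponent≥1 l)

  p²∣pwᵢ : ps i * ps i ∣ pw i
  p²∣pwᵢ = n*n∣n^m (ps i) 2≤mᵢ

  d₁ d₂ : ℕ
  d₁ = pw j
  d₂ = pw j * ps i

  d₂∣N : d₂ ∣ N
  d₂∣N = subst (d₂ ∣_) (sym (split j)) (*-monoʳ-∣ (pw j) pᵢ∣cofactor)
    where
    pᵢ∣cofactor : ps i ∣ cofactor j
    pᵢ∣cofactor = [ (λ pᵢ∣pwⱼ → ⊥-elim (p∤pw i≢j pᵢ∣pwⱼ)) , id ]′
                    (euclidsLemma (pw j) (cofactor j) (prime i) (subst (ps i ∣_) (split j) (p∣N i)))

  pw∣d₂⇒pw∣d₁ : ∀ l → pw l ∣ d₂ → pw l ∣ d₁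
  pw∣d₂⇒pw∣d₁ l pw∣d₂ with l Fin.≟ j
  ... | yes refl = ∣-refl
  ... | no l≢j = ⊥-elim (¬prime[1] (subst Prime pᵢ≡1 (prime i)))
    where
    pwₗ∣pᵢ : pw l ∣ ps i
    pwₗ∣pᵢ = coprime-divisor (prime^-coprime (ms l) (prime l) (p∤pw l≢j)) pw∣d₂
    l≡i : l ≡ i
    l≡i = injective (prime∣prime⇒≡ (prime l) (prime i) (∣-trans (p∣pw l) pwₗ∣pᵢ))
    pᵢ≡1 : ps i ≡ 1
    pᵢ≡1 = ∣1⇒≡1 (*-cancelˡ-∣ (ps i) {{prime⇒nonZero (prime i)}}
      (subst (ps i * ps i ∣_) (sym (*-identityʳ (ps i)))
             (∣-trans p²∣pwᵢ (subst (λ l → pw l ∣ ps i) l≡i pwₗ∣pᵢ))))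

  1<d₁ : 1 < d₁
  1<d₁ = <-≤-trans (nonTrivial⇒n>1 (ps j) {{prime⇒nonTrivial (prime j)}})
                   (∣⇒≤ {{m^n≢0 (ps j) (ms j)}} (p∣pw j))

  d₁<d₂ : d₁ < d₂
  d₁<d₂ = m<m*n d₁ (ps i) {{>-nonZero (<-trans z<s 1<d₁)}}
                (nonTrivial⇒n>1 (ps i) {{prime⇒nonTrivial (prime i)}})

  d₂<N : d₂ < N
  d₂<N = ≤∧≢⇒< (∣⇒≤ d₂∣N) λ d₂≡N →
    p∤pw i≢j (∣-trans (p∣pw i) (pw∣d₂⇒pw∣d₁ i (subst (pw i ∣_) (sym d₂≡N) (pw∣N i))))

  vertex-d₁ : ∃ λ a → gen a ≡ d₁
  vertex-d₁ = divisor⇒vertex (∣-trans (m∣m*n (ps i)) d₂∣N) 1<d₁ (<-trans d₁<d₂ d₂<N)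

  vertex-d₂ : ∃ λ b → gen b ≡ d₂
  vertex-d₂ = divisor⇒vertex d₂∣N (<-trans 1<d₁ d₁<d₂) d₂<N

  a = proj₁ vertex-d₁
  b = proj₁ vertex-d₂
  gen-a = proj₂ vertex-d₁
  gen-b = proj₂ vertex-d₂

  zeroEigenvalue : ZeroIsEigenvalue (numVertices N) (adjMatrix N)
  zeroEigenvalue = twins⇒zeroEigenvalue a b a≢b (equal-pw-divisors⇒twins
    (λ l pw∣ga → subst (pw l ∣_) (sym gen-b) (∣-trans (subst (pw l ∣_) gen-a pw∣ga) (m∣m*n (ps i))))
    (λ l pw∣gb → subst (pw l ∣_) (sym gen-a) (pw∣d₂⇒pw∣d₁ l (subst (pw l ∣_) gen-b pw∣gb)))
    (j , subst (pw j ∣_) (sym gen-a) ∣-refl))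
    where
    a≢b : a ≢ b
    a≢b a≡b = <⇒≢ d₁<d₂ (trans (sym gen-a) (trans (cong gen a≡b) gen-b))

nonsingular⇒prime-cube : ∀ m {k} {ps ms : Fin (suc k) → ℕ} → Factorisation (suc m) ps ms →
                         Nonsingular (suc m) → ∀ i → 2 ≤ ms i → suc k ≡ 1 × (∀ l → 2 < ms l)
nonsingular⇒prime-cube m {zero} {ms = ms} F nonsingular zero 2≤m₀ with 2 <? ms zero
... | yes 2<m₀ = refl , λ { zero → 2<m₀ }
... | no 2≮m₀ =
  ⊥-elim (nonsingular (PrimePower.square⇒zeroEigenvalue m F (sym (≤-antisym 2≤m₀ (≮⇒≥ 2≮m₀)))))
nonsingular⇒prime-cube m {suc k} F nonsingular i 2≤mᵢ =
  ⊥-elim (nonsingular (TwinVertices.zeroEigenvalue m F (proj₂ (other i)) 2≤mᵢ))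
  where
  other : ∀ (i : Fin (suc (suc k))) → ∃ λ j → i ≢ j
  other zero = suc zero , λ ()
  other (suc _) = zero , λ ()

characterisation : ∀ m {k} {ps ms : Fin k → ℕ} → Factorisation (suc m) ps ms → 1 ≤ k →
                   Nonsingular (suc m) ⇔ ((k ≡ 1 × (∀ i → 2 < ms i)) ⊎ (∀ i → ms i ≡ 1))
characterisation m {suc k} {ms = ms} F _ = mk⇔ to from
  where
  from : (suc k ≡ 1 × (∀ i → 2 < ms i)) ⊎ (∀ i → ms i ≡ 1) → Nonsingular (suc m)
  from (inj₁ (refl , cube)) = PrimePower.cube⇒nonsingular m F (cube zero)
  from (inj₂ squarefree) = Squarefree.nonsingular m F squarefree
  to : Nonsingular (suc m) → (suc k ≡ 1 × (∀ i → 2 < ms i)) ⊎ (∀ i → ms i ≡ 1)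
  to nonsingular with Finₚ.all? (λ l → ms l ≟ 1)
  ... | yes squarefree = inj₂ squarefree
  ... | no ¬squarefree =
    let i , mᵢ≢1 = Finₚ.¬∀⟶∃¬ (suc k) (λ l → ms l ≡ 1) (λ l → ms l ≟ 1) ¬squarefree
    in inj₁ (nonsingular⇒prime-cube m F nonsingular i (≤∧≢⇒< (Factorisation.exponent≥1 F i) (mᵢ≢1 ∘ sym)))

mainTheorem7 : (k : ℕ) (ps ms : Fin k → ℕ)
    → 1 ≤ k
    → (∀ i → Prime (ps i))
    → Injective _≡_ _≡_ ps
    → (∀ i → 1 ≤ ms i)
    → ¬ Prime (prodPow k ps ms)
    → (¬ ZeroIsEigenvalue (numVertices (prodPow k ps ms)) (adjMatrix (prodPow k ps ms)))
    ⇔ ((k ≡ 1 × (∀ i → 2 < ms i)) ⊎ (∀ i → ms i ≡ 1))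
mainTheorem7 k ps ms 1≤k primes injective exponent≥1 _
  with prodPow k ps ms | prodPow-factorisation k ps ms primes injective exponent≥1 | prodPow-nonZero k ps ms primes
... | suc m | F | _ = characterisation m F 1≤k
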